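{- If $r:A$ and $r:B$, then $A\equiv B$.
   Context: Types are generated by $A ::= \tau \mid A\Rightarrow A \mid A\wedge A$, where $\tau$ is the only atomic type ($\Rightarrow$ associates to the right). Type equivalence $\equiv$ is the smallest congruence on types such that $A\wedge B\equiv B\wedge A$, $A\wedge(B\wedge C)\equiv(A\wedge B)\wedge C$, $A\Rightarrow(B\wedge C)\equiv(A\Rightarrow B)\wedge(A\Rightarrow C)$ and $(A\wedge B)\Rightarrow C\equiv A\Rightarrow B\Rightarrow C$. To each type $A$ is associated an infinite set of variables $\mathcal V_A$, with $\mathcal V_A=\mathcal V_B$ if $A\equiv B$ and $\mathcal V_A\cap\mathcal V_B=\emptyset$ otherwise. Preterms are $r ::= x \mid \lambda x.r \mid rr \mid r\times r \mid \pi_A(r)$; one writes $\lambda x^A.r$ for $\lambda x.r$ when $x\in\mathcal V_A$. The typing judgement $r:A$ (without contexts) is given by: $x:A$ if $x\in\mathcal V_A$; if $r:A$ and $A\equiv B$ then $r:B$; if $r:B$ then $\lambda x^A.r:A\Rightarrow B$; if $r:A\Rightarrow B$ and $s:A$ then $rs:B$; if $r:A$ and $s:B$ then $r\times s:A\wedge B$; if $r:A\wedge B$ then $\pi_A(r):A$. -}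

module Defs where

open import Data.Nat using (ℕ)

infixr 7 _⇒_
infixr 8 _∧_

data Type : Set where
  τ   : Type
  _⇒_ : Type → Type → Type
  _∧_ : Type → Type → Type

infix 4 _≡ᵗ_

data _≡ᵗ_ : Type → Type → Set where
  ≡-refl  : ∀ {A} → A ≡ᵗ A
  ≡-sym   : ∀ {A B} → A ≡ᵗ B → B ≡ᵗ A
  ≡-trans : ∀ {A B C} → A ≡ᵗ B → B ≡ᵗ C → A ≡ᵗ C
  ≡-cong⇒ : ∀ {A A' B B'} → A ≡ᵗ A' → B ≡ᵗ B' → (A ⇒ B) ≡ᵗ (A' ⇒ B')
  ≡-cong∧ : ∀ {A A' B B'} → A ≡ᵗ A' → B ≡ᵗ B' → (A ∧ B) ≡ᵗ (A' ∧ B')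
  ∧-comm  : ∀ {A B} → (A ∧ B) ≡ᵗ (B ∧ A)
  ∧-assoc : ∀ {A B C} → (A ∧ (B ∧ C)) ≡ᵗ ((A ∧ B) ∧ C)
  ⇒-dist  : ∀ {A B C} → (A ⇒ (B ∧ C)) ≡ᵗ ((A ⇒ B) ∧ (A ⇒ C))
  curry   : ∀ {A B C} → ((A ∧ B) ⇒ C) ≡ᵗ (A ⇒ B ⇒ C)

-- Variables: a variable is a name tagged by a type; x ∈ 𝒱_A iff its tag is
-- equivalent to A.  Hence each 𝒱_A is infinite, 𝒱_A = 𝒱_B when A ≡ B, and
-- 𝒱_A ∩ 𝒱_B = ∅ otherwise.
record Var : Set where
  constructor v
  field
    tag  : Type
    name : ℕ

infix 4 _∈𝒱_
_∈𝒱_ : Var → Type → Set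
x ∈𝒱 A = Var.tag x ≡ᵗ A

data Term : Set where
  var  : Var → Term
  lam  : Var → Term → Term
  app  : Term → Term → Term
  pair : Term → Term → Term
  proj : Type → Term → Term

infix 3 _∶_

data _∶_ : Term → Type → Set where
  ty-var  : ∀ {x A} → x ∈𝒱 A → var x ∶ A
  ty-conv : ∀ {r A B} → r ∶ A → A ≡ᵗ B → r ∶ B
  ty-lam  : ∀ {x r A B} → x ∈𝒱 A → r ∶ B → lam x r ∶ A ⇒ B
  ty-app  : ∀ {r s A B} → r ∶ A ⇒ B → s ∶ A → app r s ∶ B
  ty-pair : ∀ {r s A B} → r ∶ A → s ∶ B → pair r s ∶ A ∧ B
  ty-proj : ∀ {r A B} → r ∶ A ∧ B → proj A r ∶ A

module Submission where

-- All cases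
-- are direct except application, which needs the cancellation law
--     A ⇒ B ≡ᵗ A ⇒ B'  implies  B ≡ᵗ B'.
-- This law is obtained from a normal form.  Modulo ≡ᵗ every type is a
-- conjunction of "prime" types A₁ ∧ … ∧ Aₙ ⇒ τ, whose premises are again
-- multisets of primes.

open import Defs
open import Data.List using (List; []; _∷_; _++_; map)
open import Data.List.Properties using (++-assoc; ++-identityʳ; map-++)
open import Data.Product using (Σ-syntax; _×_; _,_)
open import Relation.Binary.PropositionalEquality
  using (_≡_; refl; sym; cong; subst; module ≡-Reasoning)

data Ins {A : Set} (y : A) : List A → List A → Set where
  here  : ∀ {ys} → Ins y ys (y ∷ ys)
  there : ∀ {z ys zs} → Ins y ys zs → Ins y (z ∷ ys) (z ∷ zs)

Ins-swap : ∀ {A : Set} {a b : A} {l₁ l₂ l₃} → Ins a l₁ l₂ → Ins b l₂ l₃ →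
           Σ[ m ∈ List A ] Ins b l₁ m × Ins a m l₃
Ins-swap i         here      = _ , here , there i
Ins-swap here      (there j) = _ , j , here
Ins-swap (there i) (there j) with Ins-swap i j
... | m , j′ , i′ = _ , there j′ , there i′

Ins-++ʳ : ∀ {A : Set} {y : A} {ys zs} l → Ins y ys zs → Ins y (ys ++ l) (zs ++ l)
Ins-++ʳ l here      = here
Ins-++ʳ l (there i) = there (Ins-++ʳ l i)

Ins-middle : ∀ {A : Set} (l : List A) {x r} → Ins x (l ++ r) (l ++ x ∷ r)
Ins-middle []      = here
Ins-middle (z ∷ l) = there (Ins-middle l)

Ins-map : ∀ {A B : Set} (f : A → B) {y ys zs} →
          Ins y ys zs → Ins (f y) (map f ys) (map f zs)
Ins-map f here      = here
Ins-map f (there i) = there (Ins-map f i)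

Ins-map⁻ : ∀ {A B : Set} {f : A → B} {y ys} (zs : List A) →
           Ins y ys (map f zs) →
           Σ[ y′ ∈ A ] Σ[ ys′ ∈ List A ] y ≡ f y′ × ys ≡ map f ys′ × Ins y′ ys′ zs
Ins-map⁻ (u ∷ us) here = u , us , refl , refl , here
Ins-map⁻ (u ∷ us) (there i) with Ins-map⁻ us i
... | y′ , ys′ , refl , refl , k = y′ , u ∷ ys′ , refl , refl , there k

-- node [a₁, …, aₙ] stands for the prime type a₁ ∧ … ∧ aₙ ⇒ τ (τ if n = 0).
data Prime : Set where
  node : List Prime → Prime

mutual
  data _≈_ : Prime → Prime → Set where
    node≈ : ∀ {xs ys} → xs ~ ys → node xs ≈ node ys

  data _~_ : List Prime → List Prime → Set where
    nil  : [] ~ []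
    cons : ∀ {x y xs ys zs} → x ≈ y → xs ~ ys → Ins y ys zs → (x ∷ xs) ~ zs

infix 4 _≈_ _~_

mutual
  ≈-refl : ∀ x → x ≈ x
  ≈-refl (node xs) = node≈ (~-refl xs)

  ~-refl : ∀ xs → xs ~ xs
  ~-refl []       = nil
  ~-refl (x ∷ xs) = cons (≈-refl x) (~-refl xs) here

≡⇒~ : ∀ {xs ys} → xs ≡ ys → xs ~ ys
≡⇒~ {xs} refl = ~-refl xs

-- Inserting matching elements on both sides of a bag equality (right side
-- at the head); this is what symmetry needs to move the inserted element.
~-insert : ∀ {y x ys zs xs} → ys ~ xs → Ins y ys zs → y ≈ x → zs ~ x ∷ xs
~-insert q               here      p = cons p q here
~-insert (cons p′ q′ i′) (there i) p = cons p′ (~-insert q′ i p) (there i′)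

mutual
  ≈-sym : ∀ {x y} → x ≈ y → y ≈ x
  ≈-sym (node≈ q) = node≈ (~-sym q)

  ~-sym : ∀ {xs ys} → xs ~ ys → ys ~ xs
  ~-sym nil          = nil
  ~-sym (cons p q i) = ~-insert (~-sym q) i (≈-sym p)

~-delete : ∀ {y ys zs ws} → Ins y ys zs → zs ~ ws →
           Σ[ w ∈ Prime ] Σ[ ws′ ∈ List Prime ] y ≈ w × ys ~ ws′ × Ins w ws′ ws
~-delete here      (cons p q i) = _ , _ , p , q , i
~-delete (there i) (cons p q j) with ~-delete i q
... | w , ws′ , p′ , q′ , k with Ins-swap k j
... | m , j′ , k′ = w , m , p′ , cons p q′ j′ , k′

mutual
  ≈-trans : ∀ {x y z} → x ≈ y → y ≈ z → x ≈ z
  ≈-trans (node≈ q) (node≈ r) = node≈ (~-trans q r)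

  ~-trans : ∀ {xs ys zs} → xs ~ ys → ys ~ zs → xs ~ zs
  ~-trans nil          r = r
  ~-trans (cons p q i) r with ~-delete i r
  ... | w , ws′ , p′ , r′ , i′ = cons (≈-trans p p′) (~-trans q r′) i′

++-cong : ∀ {xs xs′ ys ys′} → xs ~ xs′ → ys ~ ys′ → xs ++ ys ~ xs′ ++ ys′
++-cong nil r = r
++-cong {ys′ = ys′} (cons p q i) r = cons p (++-cong q r) (Ins-++ʳ ys′ i)

++-comm : ∀ xs ys → xs ++ ys ~ ys ++ xs
++-comm []       ys = ≡⇒~ (sym (++-identityʳ ys))
++-comm (x ∷ xs) ys = cons (≈-refl x) (++-comm xs ys) (Ins-middle ys)

map-cong : ∀ {f g : Prime → Prime} → (∀ {x x′} → x ≈ x′ → f x ≈ g x′) →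
           ∀ {xs ys} → xs ~ ys → map f xs ~ map g ys
map-cong         h nil          = nil
map-cong {g = g} h (cons p q i) = cons (h p) (map-cong h q) (Ins-map g i)

∷-cancel : ∀ {x c d} → x ∷ c ~ x ∷ d → c ~ d
∷-cancel (cons p q here)      = q
∷-cancel (cons p q (there i)) = ~-trans q (cons p (~-refl _) i)

++-cancel : ∀ a {c d} → a ++ c ~ a ++ d → c ~ d
++-cancel []      h = h
++-cancel (x ∷ a) h = ++-cancel a (∷-cancel h)

-- prefix a (node c) adds the premises a to the prime c ⇒ τ, i.e. it is
-- the prime-level action of  A ⇒ _  when a is the normal form of A.
prefix : List Prime → Prime → Prime
prefix a (node c) = node (a ++ c)

prefix-cong : ∀ {a a′ x x′} → a ~ a′ → x ≈ x′ → prefix a x ≈ prefix a′ x′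
prefix-cong q (node≈ r) = node≈ (++-cong q r)

prefix-cancel : ∀ a x y → prefix a x ≈ prefix a y → x ≈ y
prefix-cancel a (node c) (node d) (node≈ q) = node≈ (++-cancel a q)

map-prefix-cancel : ∀ a b b′ → map (prefix a) b ~ map (prefix a) b′ → b ~ b′
map-prefix-cancel a []      []      h = nil
map-prefix-cancel a (x ∷ b) b′ (cons p q i) with Ins-map⁻ b′ i
... | y′ , ys′ , refl , refl , k =
  cons (prefix-cancel a x y′ p) (map-prefix-cancel a b ys′ q) k

-- Prefixing a ++ b is prefixing b, then a (currying at the prime level).
map-prefix-++ : ∀ a b c → map (prefix (a ++ b)) c ≡ map (prefix a) (map (prefix b) c)
map-prefix-++ a b []           = refl
map-prefix-++ a b (node x ∷ c) = begin
  node ((a ++ b) ++ x) ∷ map (prefix (a ++ b)) c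
    ≡⟨ cong (λ t → node t ∷ map (prefix (a ++ b)) c) (++-assoc a b x) ⟩
  node (a ++ b ++ x) ∷ map (prefix (a ++ b)) c
    ≡⟨ cong (node (a ++ b ++ x) ∷_) (map-prefix-++ a b c) ⟩
  node (a ++ b ++ x) ∷ map (prefix a) (map (prefix b) c) ∎
  where open ≡-Reasoning

nf : Type → List Prime
nf τ       = node [] ∷ []
nf (X ∧ Y) = nf X ++ nf Y
nf (X ⇒ Y) = map (prefix (nf X)) (nf Y)

nf-sound : ∀ {X Y} → X ≡ᵗ Y → nf X ~ nf Y
nf-sound {X} ≡-refl          = ~-refl (nf X)
nf-sound (≡-sym e)           = ~-sym (nf-sound e)
nf-sound (≡-trans e f)       = ~-trans (nf-sound e) (nf-sound f)
nf-sound (≡-cong⇒ e f)       = map-cong (prefix-cong (nf-sound e)) (nf-sound f)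
nf-sound (≡-cong∧ e f)       = ++-cong (nf-sound e) (nf-sound f)
nf-sound (∧-comm {A} {B})    = ++-comm (nf A) (nf B)
nf-sound (∧-assoc {A} {B} {C}) = ≡⇒~ (sym (++-assoc (nf A) (nf B) (nf C)))
nf-sound (⇒-dist {A} {B} {C})  = ≡⇒~ (map-++ (prefix (nf A)) (nf B) (nf C))
nf-sound (curry {A} {B} {C})   = ≡⇒~ (map-prefix-++ (nf A) (nf B) (nf C))

-- ⟦ x ∷ xs ⟧ is the conjunction of the primes in the list, nested to the
-- right; the empty list (which never arises as a normal form) gives τ.
mutual
  ⟦_⟧ᴾ : Prime → Type
  ⟦ node [] ⟧ᴾ       = τ
  ⟦ node (a ∷ as) ⟧ᴾ = ⟦ a ∷ as ⟧ ⇒ τ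

  ⟦_⟧ : List Prime → Type
  ⟦ [] ⟧         = τ
  ⟦ x ∷ [] ⟧     = ⟦ x ⟧ᴾ
  ⟦ x ∷ y ∷ l ⟧  = ⟦ x ⟧ᴾ ∧ ⟦ y ∷ l ⟧

data NonEmpty : List Prime → Set where
  nonEmpty : ∀ {x xs} → NonEmpty (x ∷ xs)

∧-swap : ∀ {A B C} → A ∧ (B ∧ C) ≡ᵗ B ∧ (A ∧ C)
∧-swap = ≡-trans ∧-assoc (≡-trans (≡-cong∧ ∧-comm ≡-refl) (≡-sym ∧-assoc))

⟦⟧-Ins : ∀ {w us zs} → NonEmpty us → Ins w us zs → ⟦ w ∷ us ⟧ ≡ᵗ ⟦ zs ⟧
⟦⟧-Ins                  nonEmpty here              = ≡-refl
⟦⟧-Ins {us = _ ∷ []}    nonEmpty (there here)      = ∧-comm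
⟦⟧-Ins {us = _ ∷ _ ∷ _} nonEmpty (there here)      = ∧-swap
⟦⟧-Ins {us = _ ∷ _ ∷ _} nonEmpty (there (there i)) =
  ≡-trans ∧-swap (≡-cong∧ ≡-refl (⟦⟧-Ins nonEmpty (there i)))

mutual
  ⟦⟧ᴾ-cong : ∀ {x y} → x ≈ y → ⟦ x ⟧ᴾ ≡ᵗ ⟦ y ⟧ᴾ
  ⟦⟧ᴾ-cong (node≈ nil)                       = ≡-refl
  ⟦⟧ᴾ-cong (node≈ q@(cons {zs = _ ∷ _} _ _ _)) = ≡-cong⇒ (⟦⟧-cong q) ≡-refl

  ⟦⟧-cong : ∀ {xs ys} → xs ~ ys → ⟦ xs ⟧ ≡ᵗ ⟦ ys ⟧
  ⟦⟧-cong nil                                 = ≡-refl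
  ⟦⟧-cong (cons {xs = []} p nil here)         = ⟦⟧ᴾ-cong p
  ⟦⟧-cong (cons {xs = _ ∷ _} p q@(cons {zs = _ ∷ _} _ _ _) i) =
    ≡-trans (≡-cong∧ (⟦⟧ᴾ-cong p) (⟦⟧-cong q)) (⟦⟧-Ins nonEmpty i)

⟦⟧-++ : ∀ x xs y ys → ⟦ x ∷ xs ++ y ∷ ys ⟧ ≡ᵗ ⟦ x ∷ xs ⟧ ∧ ⟦ y ∷ ys ⟧
⟦⟧-++ x []        y ys = ≡-refl
⟦⟧-++ x (x′ ∷ xs) y ys = ≡-trans (≡-cong∧ ≡-refl (⟦⟧-++ x′ xs y ys)) ∧-assoc

⟦⟧-prefix : ∀ x xs y → ⟦ prefix (x ∷ xs) y ⟧ᴾ ≡ᵗ ⟦ x ∷ xs ⟧ ⇒ ⟦ y ⟧ᴾ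
⟦⟧-prefix x xs (node [])       =
  subst (λ l → ⟦ x ∷ l ⟧ ⇒ τ ≡ᵗ ⟦ x ∷ xs ⟧ ⇒ τ) (sym (++-identityʳ xs)) ≡-refl
⟦⟧-prefix x xs (node (c ∷ cs)) = ≡-trans (≡-cong⇒ (⟦⟧-++ x xs c cs) ≡-refl) curry

⟦⟧-map-prefix : ∀ x xs y ys →
  ⟦ map (prefix (x ∷ xs)) (y ∷ ys) ⟧ ≡ᵗ ⟦ x ∷ xs ⟧ ⇒ ⟦ y ∷ ys ⟧
⟦⟧-map-prefix x xs y []        = ⟦⟧-prefix x xs y
⟦⟧-map-prefix x xs y (y′ ∷ ys) =
  ≡-trans (≡-cong∧ (⟦⟧-prefix x xs y) (⟦⟧-map-prefix x xs y′ ys)) (≡-sym ⇒-dist)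

nf-nonEmpty : ∀ X → NonEmpty (nf X)
nf-nonEmpty τ       = nonEmpty
nf-nonEmpty (X ⇒ Y) with nf Y | nf-nonEmpty Y
... | _ ∷ _ | nonEmpty = nonEmpty
nf-nonEmpty (X ∧ Y) with nf X | nf-nonEmpty X
... | _ ∷ _ | nonEmpty = nonEmpty

nf-complete : ∀ X → X ≡ᵗ ⟦ nf X ⟧
nf-complete τ       = ≡-refl
nf-complete (X ⇒ Y) with nf X | nf Y | nf-nonEmpty X | nf-nonEmpty Y | nf-complete X | nf-complete Y
... | x ∷ xs | y ∷ ys | nonEmpty | nonEmpty | eX | eY =
  ≡-trans (≡-cong⇒ eX eY) (≡-sym (⟦⟧-map-prefix x xs y ys))
nf-complete (X ∧ Y) with nf X | nf Y | nf-nonEmpty X | nf-nonEmpty Y | nf-complete X | nf-complete Y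
... | x ∷ xs | y ∷ ys | nonEmpty | nonEmpty | eX | eY =
  ≡-trans (≡-cong∧ eX eY) (≡-sym (⟦⟧-++ x xs y ys))

nf-reflects : ∀ {X Y} → nf X ~ nf Y → X ≡ᵗ Y
nf-reflects {X} {Y} q = ≡-trans (nf-complete X) (≡-trans (⟦⟧-cong q) (≡-sym (nf-complete Y)))

-- Prefixing is cancellative on bags, and ≡ᵗ is bag equality of normal forms.
⇒-cancelʳ : ∀ {A B B′} → A ⇒ B ≡ᵗ A ⇒ B′ → B ≡ᵗ B′
⇒-cancelʳ {A} {B} {B′} e =
  nf-reflects (map-prefix-cancel (nf A) (nf B) (nf B′) (nf-sound e))

mainTheorem5 : ∀ {r : Term} {A B : Type} → r ∶ A → r ∶ B → A ≡ᵗ B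
mainTheorem5 (ty-conv d e) d′ = ≡-trans (≡-sym e) (mainTheorem5 d d′)
mainTheorem5 d (ty-conv d′ e) = ≡-trans (mainTheorem5 d d′) e
mainTheorem5 (ty-var p) (ty-var q) = ≡-trans (≡-sym p) q
mainTheorem5 (ty-lam p d) (ty-lam q d′) = ≡-cong⇒ (≡-trans (≡-sym p) q) (mainTheorem5 d d′)
mainTheorem5 (ty-app d₁ d₂) (ty-app e₁ e₂) =
  -- r ∶ A ⇒ B and r ∶ A′ ⇒ B′ with A ≡ᵗ A′ give A ⇒ B ≡ᵗ A ⇒ B′
  ⇒-cancelʳ (≡-trans (mainTheorem5 d₁ e₁) (≡-cong⇒ (≡-sym (mainTheorem5 d₂ e₂)) ≡-refl))
mainTheorem5 (ty-pair d₁ d₂) (ty-pair e₁ e₂) = ≡-cong∧ (mainTheorem5 d₁ e₁) (mainTheorem5 d₂ e₂)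
mainTheorem5 (ty-proj d) (ty-proj e) = ≡-refl
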